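{- Let $x<w$ in $\widetilde{S}_n$ (Bruhat order), and let $i$ be an integer such that $x_i=w_i$ and $d_{x,w}(i,x_i)=d'_{x,w}(i,x_i)=0$. Then $\ell(w)-\ell(x)=\ell(w^{\hat i})-\ell(x^{\hat i})$.
   Context: $\widetilde{S}_n$ is the set of bijections $w:\mathbb{Z}\to\mathbb{Z}$ with $w(i+n)=w(i)+n$ and $\sum_{i=1}^n w(i)=\binom{n+1}{2}$; write $w_i=w(i)$; it carries the Coxeter length $\ell$ ($\ell(w)=\#\{(a,b):1\le a\le n,\ a<b,\ w_a>w_b\}$) and Bruhat order of the affine Weyl group of type $\widetilde{A}_{n-1}$. Rank functions: $r_w(p,q)=\#\{j\le p: w_j\ge q\}$, $r'_w(p,q)=\#\{j\ge p:w_j\le q\}$; difference functions $d_{x,w}=r_w-r_x$, $d'_{x,w}=r'_w-r'_x$. For $i\in\mathbb{Z}$, $w^{\hat i}\in\widetilde{S}_{n-1}$ is obtained from the point set $\{(j,w_j):j\in\mathbb{Z}\}\subset\mathbb{Z}^2$ by deleting all columns $i+kn$ and rows $w_i+kn$ ($k\in\mathbb{Z}$), and relabeling the remaining columns and rows order-preservingly by $\mathbb{Z}$ so that the resulting bijection has period $n-1$ and $w^{\hat i}_1+\dots+w^{\hat i}_{n-1}=\binom{n}{2}$ (this determines it uniquely). -}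

module Defs where

open import Data.Bool using (Bool; true; false)
open import Data.Nat as ℕ using (ℕ; zero; suc)
open import Data.Nat.Combinatorics using (_C_)
open import Data.Integer as ℤ using (ℤ; +_; -[1+_]; _+_; _-_; _*_; ∣_∣; _≤_; _<_)
open import Data.Integer.Properties using (_≤?_; _<?_)
open import Data.Integer.Divisibility using (_∣_)
open import Data.Product using (Σ; ∃; _×_; _,_)
open import Relation.Nullary using (¬_; does)
open import Relation.Binary.PropositionalEquality using (_≡_)
open import Relation.Binary.Construct.Closure.Transitive using (TransClosure)
open import Function.Definitions using (Bijective)

_≡[mod_]_ : ℤ → ℕ → ℤ → Set
a ≡[mod n ] b = (+ n) ∣ (a - b)

countFrom : (ℤ → Bool) → ℤ → ℕ → ℕ
countFrom P lo zero = 0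
countFrom P lo (suc len) with P lo
... | true  = suc (countFrom P (lo + + 1) len)
... | false = countFrom P (lo + + 1) len

intervalLength : ℤ → ℤ → ℕ
intervalLength lo hi with (hi + + 1) - lo
... | + k = k
... | -[1+ _ ] = 0

countIn : (ℤ → Bool) → ℤ → ℤ → ℕ
countIn P lo hi = countFrom P lo (intervalLength lo hi)

sumFromℤ : (ℤ → ℤ) → ℤ → ℕ → ℤ
sumFromℤ f lo zero = + 0
sumFromℤ f lo (suc len) = f lo + sumFromℤ f (lo + + 1) len

sumFromℕ : (ℤ → ℕ) → ℤ → ℕ → ℕ
sumFromℕ f lo zero = 0
sumFromℕ f lo (suc len) = f lo ℕ.+ sumFromℕ f (lo + + 1) len

record AffPerm (n : ℕ) : Set where
  field
    fun       : ℤ → ℤ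
    bijective : Bijective _≡_ _≡_ fun
    periodic  : ∀ j → fun (j + + n) ≡ fun j + + n
    window    : sumFromℤ fun (+ 1) n ≡ + (suc n C 2)
open AffPerm public

-- D w = Σ_{j=1}^{n} |w_j - j|; by periodicity |w_j - j| ≤ D w for all j ∈ ℤ.
disp : ∀ {n} → AffPerm n → ℕ
disp {n} w = sumFromℕ (λ j → ∣ fun w j - j ∣) (+ 1) n

-- Coxeter length ℓ(w) = #{(a,b) : 1 ≤ a ≤ n, a < b, w_a > w_b}.
-- If a < b and w_b < w_a then b - D ≤ w_b < w_a ≤ a + D, so b < a + 2D:
-- it suffices to let b range over [a+1, a+2D].
len : ∀ {n} → AffPerm n → ℕ
len {n} w = sumFromℕ invAt (+ 1) n
  where
    invAt : ℤ → ℕ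
    invAt a = countIn (λ b → does (fun w b <? fun w a)) (a + + 1) (a + + (2 ℕ.* disp w))

-- r_w(p,q) = #{ j ≤ p : w_j ≥ q }.  Since w_j ≥ q forces j ≥ q - D, j ranges over [q - D, p].
rank : ∀ {n} → AffPerm n → ℤ → ℤ → ℕ
rank w p q = countIn (λ j → does (q ≤? fun w j)) (q - + disp w) p

-- r'_w(p,q) = #{ j ≥ p : w_j ≤ q }.  Since w_j ≤ q forces j ≤ q + D, j ranges over [p, q + D].
rank' : ∀ {n} → AffPerm n → ℤ → ℤ → ℕ
rank' w p q = countIn (λ j → does (fun w j ≤? q)) p (q + + disp w)

d : ∀ {n} → AffPerm n → AffPerm n → ℤ → ℤ → ℤ
d x w p q = + rank w p q - + rank x p q

d' : ∀ {n} → AffPerm n → AffPerm n → ℤ → ℤ → ℤ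
d' x w p q = + rank' w p q - + rank' x p q

-- w = u · t_{a,b}, where t_{a,b} (a < b, a ≢ b mod n) is the affine reflection
-- exchanging a + kn and b + kn for all k (right multiplication swaps positions).
IsRightReflect : ∀ {n} → AffPerm n → AffPerm n → Set
IsRightReflect {n} u w =
  Σ ℤ λ a → Σ ℤ λ b → a < b × ¬ (a ≡[mod n ] b) ×
    (∀ j → (j ≡[mod n ] a → fun w j ≡ fun u (j + (b - a)))
         × (j ≡[mod n ] b → fun w j ≡ fun u (j - (b - a)))
         × (¬ (j ≡[mod n ] a) → ¬ (j ≡[mod n ] b) → fun w j ≡ fun u j))

BruhatStep : ∀ {n} → AffPerm n → AffPerm n → Set
BruhatStep u w = IsRightReflect u w × len u ℕ.< len w

_<B_ : ∀ {n} → AffPerm n → AffPerm n → Set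
_<B_ = TransClosure BruhatStep

-- v = w^{î}: the remaining columns (j ≢ i mod n) are enumerated order-preservingly
-- by f : ℤ → ℤ, the remaining rows (r ≢ w_i mod n) by g : ℤ → ℤ, and
-- v is the induced bijection: w (f k) = g (v k).  (v ∈ S̃_{n-1}; the window
-- normalisation is part of AffPerm.)
IsDeletion : ∀ {n} → AffPerm n → ℤ → AffPerm (n ℕ.∸ 1) → Set
IsDeletion {n} w i v =
  Σ (ℤ → ℤ) λ f → Σ (ℤ → ℤ) λ g →
    (∀ k l → k < l → f k < f l) ×
    (∀ k → ¬ (f k ≡[mod n ] i)) ×
    (∀ j → ¬ (j ≡[mod n ] i) → ∃ λ k → f k ≡ j) ×
    (∀ k l → k < l → g k < g l) ×
    (∀ k → ¬ (g k ≡[mod n ] fun w i)) ×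
    (∀ r → ¬ (r ≡[mod n ] fun w i) → ∃ λ k → g k ≡ r) ×
    (∀ k → fun w (f k) ≡ g (fun v k))

module Submission where

-- Count ℓ(w) as the number of inversions (a, b), a < b, with a in the window i, i+1, …, i+n−1.
-- The inversions starting at a = i number r'_w(i, w_i) − 1.  For i < a < i+n, a partner b of a is
-- either ≢ i (mod n): these correspond, through the order-preserving relabelling of the remaining
-- columns and rows, exactly to the inversions of w^î counted over one of its windows; or b = i + pn
-- with p ≥ 1: translating the pair by −pn turns these into the j < i with w_j > w_i, which number
-- r_w(i, w_i) − 1.  Hence ℓ(w) + 2 = ℓ(w^î) + r_w(i, w_i) + r'_w(i, w_i).  The hypotheses x_i = w_i
-- and d = d' = 0 make the rank terms equal for x and w, so they cancel in the difference.

open import Defs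
open import Data.Bool using (Bool; true; false; _∧_; not)
open import Data.Bool.Properties using (∧-zeroʳ)
open import Data.Empty using (⊥; ⊥-elim)
open import Data.Integer as ℤ using (ℤ; +_; -[1+_]; _+_; _-_; _*_; -_; ∣_∣; _≤_; _<_)
open import Data.Integer.DivMod using (_%ℕ_; _/ℕ_; a≡a%ℕn+[a/ℕn]*n; n%ℕd<d)
import Data.Integer.Divisibility.Signed as ℤD
import Data.Integer.Properties as ℤₚ
open import Data.Integer.Properties using (_<?_; _≤?_)
open import Data.Integer.Tactic.RingSolver using (solve-∀)
open import Data.Nat as ℕ using (ℕ; zero; suc; z≤n; s≤s; _∸_)
import Data.Nat.Divisibility as ℕD
import Data.Nat.Properties as ℕₚ
open import Data.Nat.Tactic.RingSolver using () renaming (solve-∀ to ℕ-solve-∀)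
open import Data.Product using (∃; _,_; proj₁; proj₂)
open import Data.Sum using ([_,_]′)
open import Function using (_∘_; mk⇔)
open import Relation.Binary.Core using (_Preserves_⟶_)
open import Relation.Binary.Definitions using (tri<; tri≈; tri>)
open import Relation.Binary.PropositionalEquality
open import Relation.Nullary using (¬_; Dec; does; contradiction)
open import Relation.Nullary.Decidable using (dec-true; dec-false; does-⇔)

open import Algebra.Properties.AbelianGroup ℤₚ.+-0-abelianGroup using () renaming (∙-cancelˡ to +-cancelˡ-≡)
open import Algebra.Properties.CommutativeSemigroup ℕₚ.+-commutativeSemigroup using () renaming (interchange to +-interchange)

i+[j-i]≡j : ∀ i j → i + (j - i) ≡ j
i+[j-i]≡j = solve-∀

i+suc[t]≡i+1+t : ∀ i t → i + + suc t ≡ (i + + 1) + + t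
i+suc[t]≡i+1+t i t = trans (cong (λ z → i + z) (ℤₚ.pos-+ 1 t)) (sym (ℤₚ.+-assoc i (+ 1) (+ t)))

i+suc[t]≡i+t+1 : ∀ i t → i + + suc t ≡ (i + + t) + + 1
i+suc[t]≡i+t+1 i t = trans (cong (λ z → i + + z) (ℕₚ.+-comm 1 t))
                            (trans (cong (λ z → i + z) (ℤₚ.pos-+ t 1)) (sym (ℤₚ.+-assoc i (+ t) (+ 1))))

i≤j⇒∃[k]j≡i+k : ∀ {i j} → i ≤ j → ∃ λ k → j ≡ i + + k
i≤j⇒∃[k]j≡i+k {i} {j} i≤j with j - i in eq | ℤₚ.i≤j⇒0≤j-i i≤j
... | + k | _ = k , trans (sym (i+[j-i]≡j i j)) (cong (λ z → i + z) eq)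

i<j⇒∃[k]j≡i+suc[k] : ∀ {i j} → i < j → ∃ λ k → j ≡ i + + suc k
i<j⇒∃[k]j≡i+suc[k] {i} i<j with i≤j⇒∃[k]j≡i+k (ℤₚ.i<j⇒suc[i]≤j i<j)
... | k , refl = k , trans (lemma i (+ k)) (cong (λ z → i + z) (sym (ℤₚ.pos-+ 1 k)))
  where lemma : ∀ i k → (+ 1 + i) + k ≡ i + (+ 1 + k)
        lemma = solve-∀

i<i+suc[k] : ∀ i k → i < i + + suc k
i<i+suc[k] i k = ℤₚ.suc[i]≤j⇒i<j (subst (+ 1 + i ≤_) eq (ℤₚ.i≤i+j (+ 1 + i) (+ k)))
  where
    lemma : ∀ i k → (+ 1 + i) + k ≡ i + (+ 1 + k)
    lemma = solve-∀
    eq : (+ 1 + i) + + k ≡ i + + suc k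
    eq = trans (lemma i (+ k)) (cong (λ z → i + z) (sym (ℤₚ.pos-+ 1 k)))

i≤j+k⇒i-k≤j : ∀ {i j k} → i ≤ j + k → i - k ≤ j
i≤j+k⇒i-k≤j {i} {j} {k} i≤j+k = subst (i - k ≤_) (lemma j k) (ℤₚ.+-monoˡ-≤ (ℤ.- k) i≤j+k)
  where lemma : ∀ j k → (j + k) - k ≡ j
        lemma = solve-∀

a+N<a+1+N+t : ∀ a N t → a + + N < ((a + + 1) + + N) + + t
a+N<a+1+N+t a N t = subst (a + + N <_) eq (i<i+suc[k] (a + + N) t)
  where
    lemma : ∀ a N t → (a + N) + (+ 1 + t) ≡ ((a + + 1) + N) + t
    lemma = solve-∀
    eq : (a + + N) + + suc t ≡ ((a + + 1) + + N) + + t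
    eq = trans (cong (λ z → (a + + N) + z) (ℤₚ.pos-+ 1 t)) (lemma a (+ N) (+ t))

i-N+t<i : ∀ i {N t} → t ℕ.< N → (i - + N) + + t < i
i-N+t<i i {t = t} t<N with ℕₚ.m≤n⇒∃[o]m+o≡n t<N
... | r , refl = subst ((i - + (suc t ℕ.+ r)) + + t <_) eq (i<i+suc[k] _ r)
  where
    lemma : ∀ i t r → ((i - ((+ 1 + t) + r)) + t) + (+ 1 + r) ≡ i
    lemma = solve-∀
    eq : ((i - + (suc t ℕ.+ r)) + + t) + + suc r ≡ i
    eq = trans (cong₂ (λ x y → ((i - x) + + t) + y)
                      (trans (ℤₚ.pos-+ (suc t) r) (cong (_+ + r) (ℤₚ.pos-+ 1 t)))
                      (ℤₚ.pos-+ 1 r))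
               (lemma i (+ t) (+ r))

i-[N+e]+t<i-N : ∀ i N {e t} → t ℕ.< e → (i - + (N ℕ.+ e)) + + t < i - + N
i-[N+e]+t<i-N i N {e} t<e = subst (λ z → z + _ < i - + N) (sym eq) (i-N+t<i (i - + N) t<e)
  where
    lemma : ∀ i N e → i - (N + e) ≡ (i - N) - e
    lemma = solve-∀
    eq : i - + (N ℕ.+ e) ≡ (i - + N) - + e
    eq = trans (cong (λ z → i - z) (ℤₚ.pos-+ N e)) (lemma i (+ N) (+ e))

i≤+∣i∣ : ∀ i → i ≤ + ∣ i ∣
i≤+∣i∣ (+ k)    = ℤₚ.≤-refl
i≤+∣i∣ -[1+ k ] = ℤ.-≤+

∣i-j∣≤k⇒i≤j+k : ∀ i j k → ∣ i - j ∣ ℕ.≤ k → i ≤ j + + k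
∣i-j∣≤k⇒i≤j+k i j k ∣i-j∣≤k = begin
  i              ≡⟨ sym (lemma i j) ⟩
  j + (i - j)    ≤⟨ ℤₚ.+-monoʳ-≤ j (ℤₚ.≤-trans (i≤+∣i∣ (i - j)) (ℤ.+≤+ ∣i-j∣≤k)) ⟩
  j + + k        ∎
  where
    open ℤₚ.≤-Reasoning
    lemma : ∀ i j → j + (i - j) ≡ i
    lemma = solve-∀

no-integer-between : ∀ {k m} → k < m → m < k + + 1 → ⊥
no-integer-between {k} {m} k<m m<k+1 =
  ℤₚ.<-irrefl refl (ℤₚ.≤-<-trans (ℤₚ.i<j⇒suc[i]≤j k<m) (subst (m <_) (ℤₚ.+-comm k (+ 1)) m<k+1))

reflects-< : ∀ (h : ℤ → ℤ) → h Preserves _<_ ⟶ _<_ → ∀ {a b} → h a < h b → a < b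
reflects-< h mono {a} {b} ha<hb with ℤₚ.<-cmp a b
... | tri< a<b _ _ = a<b
... | tri≈ _ refl _ = ⊥-elim (ℤₚ.<-irrefl refl ha<hb)
... | tri> _ _ b<a = ⊥-elim (ℤₚ.<-asym (mono b<a) ha<hb)

+-cancelʳ-< : ∀ c {a b} → a + c < b + c → a < b
+-cancelʳ-< c = reflects-< (_+ c) (ℤₚ.+-monoˡ-< c)

does-<-shift : ∀ x y c → does (x <? y - c) ≡ does (x + c <? y)
does-<-shift x y c = does-⇔ (mk⇔ (λ lt → subst (x + c <_) (lemma y c) (ℤₚ.+-monoˡ-< c lt))
                                  (λ lt → +-cancelʳ-< c (subst (x + c <_) (sym (lemma y c)) lt)))
                             (x <? y - c) (x + c <? y)
  where lemma : ∀ y c → (y - c) + c ≡ y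
        lemma = solve-∀

sum-cong : ∀ {F G : ℤ → ℕ} lo lo′ N → (∀ t → t ℕ.< N → F (lo + + t) ≡ G (lo′ + + t)) →
           sumFromℕ F lo N ≡ sumFromℕ G lo′ N
sum-cong lo lo′ zero    eq = refl
sum-cong {F} {G} lo lo′ (suc N) eq = cong₂ ℕ._+_ head (sum-cong (lo + + 1) (lo′ + + 1) N tail)
  where
    head : F lo ≡ G lo′
    head = subst₂ (λ a b → F a ≡ G b) (ℤₚ.+-identityʳ lo) (ℤₚ.+-identityʳ lo′) (eq 0 (s≤s z≤n))
    tail : ∀ t → t ℕ.< N → F ((lo + + 1) + + t) ≡ G ((lo′ + + 1) + + t)
    tail t t<N = subst₂ (λ a b → F a ≡ G b) (i+suc[t]≡i+1+t lo t) (i+suc[t]≡i+1+t lo′ t) (eq (suc t) (s≤s t<N))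

sum-++ : ∀ F lo a b → sumFromℕ F lo (a ℕ.+ b) ≡ sumFromℕ F lo a ℕ.+ sumFromℕ F (lo + + a) b
sum-++ F lo zero    b = cong (λ z → sumFromℕ F z b) (sym (ℤₚ.+-identityʳ lo))
sum-++ F lo (suc a) b = begin
  F lo ℕ.+ sumFromℕ F (lo + + 1) (a ℕ.+ b)
    ≡⟨ cong (λ z → F lo ℕ.+ z) (sum-++ F (lo + + 1) a b) ⟩
  F lo ℕ.+ (sumFromℕ F (lo + + 1) a ℕ.+ sumFromℕ F ((lo + + 1) + + a) b)
    ≡⟨ sym (ℕₚ.+-assoc (F lo) _ _) ⟩
  sumFromℕ F lo (suc a) ℕ.+ sumFromℕ F ((lo + + 1) + + a) b
    ≡⟨ cong (λ z → sumFromℕ F lo (suc a) ℕ.+ sumFromℕ F z b) (sym (i+suc[t]≡i+1+t lo a)) ⟩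
  sumFromℕ F lo (suc a) ℕ.+ sumFromℕ F (lo + + suc a) b ∎
  where open ≡-Reasoning

sum-snoc : ∀ F lo N → sumFromℕ F lo (suc N) ≡ sumFromℕ F lo N ℕ.+ F (lo + + N)
sum-snoc F lo N = begin
  sumFromℕ F lo (suc N)                              ≡⟨ cong (sumFromℕ F lo) (ℕₚ.+-comm 1 N) ⟩
  sumFromℕ F lo (N ℕ.+ 1)                            ≡⟨ sum-++ F lo N 1 ⟩
  sumFromℕ F lo N ℕ.+ (F (lo + + N) ℕ.+ 0)           ≡⟨ cong (sumFromℕ F lo N ℕ.+_) (ℕₚ.+-identityʳ _) ⟩
  sumFromℕ F lo N ℕ.+ F (lo + + N)                   ∎
  where open ≡-Reasoning

sum-zero : ∀ lo N → sumFromℕ (λ _ → 0) lo N ≡ 0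
sum-zero lo zero    = refl
sum-zero lo (suc N) = sum-zero (lo + + 1) N

sum-distrib-+ : ∀ F G lo N → sumFromℕ (λ a → F a ℕ.+ G a) lo N ≡ sumFromℕ F lo N ℕ.+ sumFromℕ G lo N
sum-distrib-+ F G lo zero    = refl
sum-distrib-+ F G lo (suc N) = begin
  (F lo ℕ.+ G lo) ℕ.+ sumFromℕ (λ a → F a ℕ.+ G a) (lo + + 1) N
    ≡⟨ cong ((F lo ℕ.+ G lo) ℕ.+_) (sum-distrib-+ F G (lo + + 1) N) ⟩
  (F lo ℕ.+ G lo) ℕ.+ (sumFromℕ F (lo + + 1) N ℕ.+ sumFromℕ G (lo + + 1) N)
    ≡⟨ +-interchange (F lo) (G lo) _ _ ⟩
  (F lo ℕ.+ sumFromℕ F (lo + + 1) N) ℕ.+ (G lo ℕ.+ sumFromℕ G (lo + + 1) N) ∎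
  where open ≡-Reasoning

sum-swap : ∀ (F : ℤ → ℤ → ℕ) lo₁ N₁ lo₂ N₂ →
  sumFromℕ (λ a → sumFromℕ (F a) lo₂ N₂) lo₁ N₁ ≡ sumFromℕ (λ b → sumFromℕ (λ a → F a b) lo₁ N₁) lo₂ N₂
sum-swap F lo₁ zero     lo₂ N₂ = sym (sum-zero lo₂ N₂)
sum-swap F lo₁ (suc N₁) lo₂ N₂ = begin
  sumFromℕ (F lo₁) lo₂ N₂ ℕ.+ sumFromℕ (λ a → sumFromℕ (F a) lo₂ N₂) (lo₁ + + 1) N₁
    ≡⟨ cong (sumFromℕ (F lo₁) lo₂ N₂ ℕ.+_) (sum-swap F (lo₁ + + 1) N₁ lo₂ N₂) ⟩
  sumFromℕ (F lo₁) lo₂ N₂ ℕ.+ sumFromℕ (λ b → sumFromℕ (λ a → F a b) (lo₁ + + 1) N₁) lo₂ N₂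
    ≡⟨ sym (sum-distrib-+ (F lo₁) _ lo₂ N₂) ⟩
  sumFromℕ (λ b → sumFromℕ (λ a → F a b) lo₁ (suc N₁)) lo₂ N₂ ∎
  where open ≡-Reasoning

term≤sum : ∀ F lo N t → t ℕ.< N → F (lo + + t) ℕ.≤ sumFromℕ F lo N
term≤sum F lo (suc N) zero    _ =
  subst (λ z → F z ℕ.≤ sumFromℕ F lo (suc N)) (sym (ℤₚ.+-identityʳ lo)) (ℕₚ.m≤m+n (F lo) _)
term≤sum F lo (suc N) (suc t) (s≤s t<N) =
  subst (λ z → F z ℕ.≤ sumFromℕ F lo (suc N)) (sym (i+suc[t]≡i+1+t lo t))
        (ℕₚ.≤-trans (term≤sum F (lo + + 1) N t t<N) (ℕₚ.m≤n+m _ (F lo)))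

shift-invariant⇒constant : ∀ (G : ℤ → ℕ) → (∀ s → G (s + + 1) ≡ G s) → ∀ s t → G s ≡ G t
shift-invariant⇒constant G inv s t = [ constant-≤ , sym ∘ constant-≤ ]′ (ℤₚ.≤-total s t)
  where
    G[s+k]≡G[s] : ∀ s k → G (s + + k) ≡ G s
    G[s+k]≡G[s] s zero    = cong G (ℤₚ.+-identityʳ s)
    G[s+k]≡G[s] s (suc k) = trans (cong G (i+suc[t]≡i+t+1 s k)) (trans (inv (s + + k)) (G[s+k]≡G[s] s k))
    constant-≤ : ∀ {s t} → s ≤ t → G s ≡ G t
    constant-≤ {s} s≤t with i≤j⇒∃[k]j≡i+k s≤t
    ... | k , refl = sym (G[s+k]≡G[s] s k)

sum-periodic : ∀ F n → (∀ a → F (a + + n) ≡ F a) → ∀ s t → sumFromℕ F s n ≡ sumFromℕ F t n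
sum-periodic F zero    _   s t = refl
sum-periodic F (suc N) per = shift-invariant⇒constant (λ s → sumFromℕ F s (suc N)) step
  where
    open ≡-Reasoning
    step : ∀ s → sumFromℕ F (s + + 1) (suc N) ≡ sumFromℕ F s (suc N)
    step s = begin
      sumFromℕ F (s + + 1) (suc N)                        ≡⟨ sum-snoc F (s + + 1) N ⟩
      sumFromℕ F (s + + 1) N ℕ.+ F ((s + + 1) + + N)      ≡⟨ cong (λ z → sumFromℕ F (s + + 1) N ℕ.+ F z) (sym (i+suc[t]≡i+1+t s N)) ⟩
      sumFromℕ F (s + + 1) N ℕ.+ F (s + + suc N)          ≡⟨ cong (sumFromℕ F (s + + 1) N ℕ.+_) (per s) ⟩
      sumFromℕ F (s + + 1) N ℕ.+ F s                      ≡⟨ ℕₚ.+-comm _ (F s) ⟩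
      sumFromℕ F s (suc N)                                ∎

𝟙 : Bool → ℕ
𝟙 true  = 1
𝟙 false = 0

count≡sum : ∀ P lo N → countFrom P lo N ≡ sumFromℕ (𝟙 ∘ P) lo N
count≡sum P lo zero = refl
count≡sum P lo (suc N) with P lo
... | true  = cong suc (count≡sum P (lo + + 1) N)
... | false = count≡sum P (lo + + 1) N

count-cons : ∀ P lo N → countFrom P lo (suc N) ≡ 𝟙 (P lo) ℕ.+ countFrom P (lo + + 1) N
count-cons P lo N with P lo
... | true  = refl
... | false = refl

count-++ : ∀ P lo a b → countFrom P lo (a ℕ.+ b) ≡ countFrom P lo a ℕ.+ countFrom P (lo + + a) b
count-++ P lo a b = begin
  countFrom P lo (a ℕ.+ b)                                 ≡⟨ count≡sum P lo (a ℕ.+ b) ⟩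
  sumFromℕ (𝟙 ∘ P) lo (a ℕ.+ b)                            ≡⟨ sum-++ (𝟙 ∘ P) lo a b ⟩
  sumFromℕ (𝟙 ∘ P) lo a ℕ.+ sumFromℕ (𝟙 ∘ P) (lo + + a) b  ≡⟨ sym (cong₂ ℕ._+_ (count≡sum P lo a) (count≡sum P (lo + + a) b)) ⟩
  countFrom P lo a ℕ.+ countFrom P (lo + + a) b            ∎
  where open ≡-Reasoning

count-snoc : ∀ P lo N → countFrom P lo (suc N) ≡ countFrom P lo N ℕ.+ 𝟙 (P (lo + + N))
count-snoc P lo N = begin
  countFrom P lo (suc N)                         ≡⟨ count≡sum P lo (suc N) ⟩
  sumFromℕ (𝟙 ∘ P) lo (suc N)                    ≡⟨ sum-snoc (𝟙 ∘ P) lo N ⟩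
  sumFromℕ (𝟙 ∘ P) lo N ℕ.+ 𝟙 (P (lo + + N))     ≡⟨ cong (ℕ._+ 𝟙 (P (lo + + N))) (sym (count≡sum P lo N)) ⟩
  countFrom P lo N ℕ.+ 𝟙 (P (lo + + N))          ∎
  where open ≡-Reasoning

count-cong : ∀ {P Q} lo lo′ N → (∀ t → t ℕ.< N → P (lo + + t) ≡ Q (lo′ + + t)) →
             countFrom P lo N ≡ countFrom Q lo′ N
count-cong {P} {Q} lo lo′ N eq = begin
  countFrom P lo N          ≡⟨ count≡sum P lo N ⟩
  sumFromℕ (𝟙 ∘ P) lo N     ≡⟨ sum-cong lo lo′ N (λ t t<N → cong 𝟙 (eq t t<N)) ⟩
  sumFromℕ (𝟙 ∘ Q) lo′ N    ≡⟨ sym (count≡sum Q lo′ N) ⟩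
  countFrom Q lo′ N         ∎
  where open ≡-Reasoning

count-none : ∀ P lo N → (∀ t → t ℕ.< N → P (lo + + t) ≡ false) → countFrom P lo N ≡ 0
count-none P lo N none = begin
  countFrom P lo N             ≡⟨ count≡sum P lo N ⟩
  sumFromℕ (𝟙 ∘ P) lo N        ≡⟨ sum-cong lo lo N (λ t t<N → cong 𝟙 (none t t<N)) ⟩
  sumFromℕ (λ _ → 0) lo N      ≡⟨ sum-zero lo N ⟩
  0                            ∎
  where open ≡-Reasoning

count-++-none : ∀ P lo N e → (∀ t → t ℕ.< e → P ((lo + + N) + + t) ≡ false) →
                countFrom P lo (N ℕ.+ e) ≡ countFrom P lo N
count-++-none P lo N e none = begin
  countFrom P lo (N ℕ.+ e)                             ≡⟨ count-++ P lo N e ⟩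
  countFrom P lo N ℕ.+ countFrom P (lo + + N) e        ≡⟨ cong (countFrom P lo N ℕ.+_) (count-none P (lo + + N) e none) ⟩
  countFrom P lo N ℕ.+ 0                               ≡⟨ ℕₚ.+-identityʳ _ ⟩
  countFrom P lo N                                     ∎
  where open ≡-Reasoning

count-none-++ : ∀ P lo e N → (∀ t → t ℕ.< e → P (lo + + t) ≡ false) →
                countFrom P lo (e ℕ.+ N) ≡ countFrom P (lo + + e) N
count-none-++ P lo e N none = trans (count-++ P lo e N) (cong (ℕ._+ countFrom P (lo + + e) N) (count-none P lo e none))

count-partition : ∀ (Q P : ℤ → Bool) lo N →
  countFrom P lo N ≡ countFrom (λ j → Q j ∧ P j) lo N ℕ.+ countFrom (λ j → not (Q j) ∧ P j) lo N
count-partition Q P lo N = begin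
  countFrom P lo N
    ≡⟨ count≡sum P lo N ⟩
  sumFromℕ (𝟙 ∘ P) lo N
    ≡⟨ sum-cong lo lo N (λ t _ → 𝟙-split (Q (lo + + t)) (P (lo + + t))) ⟩
  sumFromℕ (λ j → 𝟙 (Q j ∧ P j) ℕ.+ 𝟙 (not (Q j) ∧ P j)) lo N
    ≡⟨ sum-distrib-+ _ _ lo N ⟩
  sumFromℕ (λ j → 𝟙 (Q j ∧ P j)) lo N ℕ.+ sumFromℕ (λ j → 𝟙 (not (Q j) ∧ P j)) lo N
    ≡⟨ sym (cong₂ ℕ._+_ (count≡sum _ lo N) (count≡sum _ lo N)) ⟩
  countFrom (λ j → Q j ∧ P j) lo N ℕ.+ countFrom (λ j → not (Q j) ∧ P j) lo N ∎
  where
    open ≡-Reasoning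
    𝟙-split : ∀ q p → 𝟙 p ≡ 𝟙 (q ∧ p) ℕ.+ 𝟙 (not q ∧ p)
    𝟙-split true  p = sym (ℕₚ.+-identityʳ (𝟙 p))
    𝟙-split false p = refl

intervalLength≡ : ∀ lo hi L → (hi + + 1) - lo ≡ + L → intervalLength lo hi ≡ L
intervalLength≡ lo hi L eq rewrite eq = refl

module _ {n} (w : AffPerm n) where
  private
    W = fun w

  fun[j+qn]≡fun[j]+qn : ∀ j q → W (j + + q * + n) ≡ W j + + q * + n
  fun[j+qn]≡fun[j]+qn j zero    = trans (cong W (lemma j (+ n))) (sym (lemma (W j) (+ n)))
    where lemma : ∀ j x → j + + 0 * x ≡ j
          lemma = solve-∀
  fun[j+qn]≡fun[j]+qn j (suc q) = begin
    W (j + + suc q * + n)          ≡⟨ cong W (step j) ⟩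
    W ((j + + q * + n) + + n)      ≡⟨ periodic w (j + + q * + n) ⟩
    W (j + + q * + n) + + n        ≡⟨ cong (_+ + n) (fun[j+qn]≡fun[j]+qn j q) ⟩
    (W j + + q * + n) + + n        ≡⟨ sym (step (W j)) ⟩
    W j + + suc q * + n            ∎
    where
      open ≡-Reasoning
      lemma : ∀ j q x → j + (+ 1 + q) * x ≡ (j + q * x) + x
      lemma = solve-∀
      step : ∀ j → j + + suc q * + n ≡ (j + + q * + n) + + n
      step j = trans (cong (λ z → j + z * + n) (ℤₚ.pos-+ 1 q)) (lemma j (+ q) (+ n))

  fun[j+pn]≡fun[j]+pn : ∀ j p → W (j + p * + n) ≡ W j + p * + n
  fun[j+pn]≡fun[j]+pn j (+ q)    = fun[j+qn]≡fun[j]+qn j q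
  fun[j+pn]≡fun[j]+pn j -[1+ q ] = begin
    W (j + -[1+ q ] * + n)                                ≡⟨ sym (cancel (W (j + -[1+ q ] * + n))) ⟩
    (W (j′) + + suc q * + n) + -[1+ q ] * + n             ≡⟨ cong (_+ -[1+ q ] * + n) (sym (fun[j+qn]≡fun[j]+qn j′ (suc q))) ⟩
    W (j′ + + suc q * + n) + -[1+ q ] * + n               ≡⟨ cong (λ z → W z + -[1+ q ] * + n) (cancel′ j) ⟩
    W j + -[1+ q ] * + n                                  ∎
    where
      open ≡-Reasoning
      j′ = j + -[1+ q ] * + n
      lemma : ∀ a p x → (a + p * x) + (- p) * x ≡ a
      lemma = solve-∀
      lemma′ : ∀ a p x → (a + (- p) * x) + p * x ≡ a
      lemma′ = solve-∀
      cancel : ∀ a → (a + + suc q * + n) + -[1+ q ] * + n ≡ a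
      cancel a = lemma a (+ suc q) (+ n)
      cancel′ : ∀ a → (a + -[1+ q ] * + n) + + suc q * + n ≡ a
      cancel′ a = lemma′ a (+ suc q) (+ n)

  fun[j-pn]≡fun[j]-pn : ∀ j p → W (j - p * + n) ≡ W j - p * + n
  fun[j-pn]≡fun[j]-pn j p = begin
    W (j + - (p * + n))      ≡⟨ cong (λ z → W (j + z)) (ℤₚ.neg-distribˡ-* p (+ n)) ⟩
    W (j + (- p) * + n)      ≡⟨ fun[j+pn]≡fun[j]+pn j (- p) ⟩
    W j + (- p) * + n        ≡⟨ cong (λ z → W j + z) (sym (ℤₚ.neg-distribˡ-* p (+ n))) ⟩
    W j + - (p * + n)        ∎
    where open ≡-Reasoning

module _ {n} .{{_ : ℕ.NonZero n}} (w : AffPerm n) where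
  private
    W = fun w
    D = disp w

  ∣fun-id∣≤disp : ∀ j → ∣ W j - j ∣ ℕ.≤ D
  ∣fun-id∣≤disp j = subst (ℕ._≤ D) (cong ∣_∣ (sym shift-to-window))
                          (term≤sum (λ j → ∣ W j - j ∣) (+ 1) n r (n%ℕd<d (j - + 1) n))
    where
      r = (j - + 1) %ℕ n
      q = (j - + 1) /ℕ n
      j≡1+r+qn : j ≡ (+ 1 + + r) + q * + n
      j≡1+r+qn = trans (sym (lemma j)) (trans (cong (λ z → + 1 + z) (a≡a%ℕn+[a/ℕn]*n (j - + 1) n)) (lemma′ (+ r) q (+ n)))
        where lemma : ∀ j → + 1 + (j - + 1) ≡ j
              lemma = solve-∀
              lemma′ : ∀ r q x → + 1 + (r + q * x) ≡ (+ 1 + r) + q * x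
              lemma′ = solve-∀
      shift-to-window : W j - j ≡ W (+ 1 + + r) - (+ 1 + + r)
      shift-to-window = trans (cong (λ z → W z - z) j≡1+r+qn)
                          (trans (cong (_- ((+ 1 + + r) + q * + n)) (fun[j+pn]≡fun[j]+pn w (+ 1 + + r) q))
                                 (lemma (W (+ 1 + + r)) (+ 1 + + r) (q * + n)))
        where lemma : ∀ a b c → (a + c) - (b + c) ≡ a - b
              lemma = solve-∀

  fun≤j+disp : ∀ j → W j ≤ j + + D
  fun≤j+disp j = ∣i-j∣≤k⇒i≤j+k (W j) j D (∣fun-id∣≤disp j)

  j≤fun+disp : ∀ j → j ≤ W j + + D
  j≤fun+disp j = ∣i-j∣≤k⇒i≤j+k j (W j) D (subst (ℕ._≤ D) (ℤₚ.∣i-j∣≡∣j-i∣ (W j) j) (∣fun-id∣≤disp j))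

-- Inversion counts

rightInversions : ∀ {n} → AffPerm n → ℤ → ℕ
rightInversions w a = countFrom (λ b → does (fun w b <? fun w a)) (a + + 1) (2 ℕ.* disp w)

rightInversionsWith : ∀ {n} → AffPerm n → (ℤ → Bool) → ℤ → ℕ
rightInversionsWith w Q a = countFrom (λ b → Q b ∧ does (fun w b <? fun w a)) (a + + 1) (2 ℕ.* disp w)

leftInversions : ∀ {n} → AffPerm n → ℤ → ℕ → ℕ
leftInversions w i N = countFrom (λ j → does (fun w i <? fun w j)) (i - + N) N

module _ {n} .{{_ : ℕ.NonZero n}} (w : AffPerm n) where
  private
    W = fun w
    D = disp w

  reach-right : ∀ a {N} → 2 ℕ.* D ℕ.≤ N → W a + + D ≤ a + + N
  reach-right a {N} 2D≤N = begin
    W a + + D          ≤⟨ ℤₚ.+-monoˡ-≤ (+ D) (fun≤j+disp w a) ⟩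
    (a + + D) + + D    ≡⟨ trans (ℤₚ.+-assoc a (+ D) (+ D)) (cong (λ z → a + z) (sym (ℤₚ.pos-+ D D))) ⟩
    a + + (D ℕ.+ D)    ≤⟨ ℤₚ.+-monoʳ-≤ a (ℤ.+≤+ (subst (ℕ._≤ N) (cong (D ℕ.+_) (ℕₚ.+-identityʳ D)) 2D≤N)) ⟩
    a + + N            ∎
    where open ℤₚ.≤-Reasoning

  reach-left : ∀ i {N} → 2 ℕ.* D ℕ.≤ N → i - + N ≤ W i - + D
  reach-left i {N} 2D≤N = begin
    i - + N            ≤⟨ ℤₚ.+-monoʳ-≤ i (ℤₚ.neg-mono-≤ (ℤ.+≤+ (subst (ℕ._≤ N) (cong (D ℕ.+_) (ℕₚ.+-identityʳ D)) 2D≤N))) ⟩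
    i - + (D ℕ.+ D)    ≡⟨ trans (cong (λ z → i - z) (ℤₚ.pos-+ D D)) (lemma i (+ D)) ⟩
    (i - + D) - + D    ≤⟨ ℤₚ.+-monoˡ-≤ (ℤ.- + D) (i≤j+k⇒i-k≤j {i} {W i} (j≤fun+disp w i)) ⟩
    W i - + D          ∎
    where
      open ℤₚ.≤-Reasoning
      lemma : ∀ i d → i - (d + d) ≡ (i - d) - d
      lemma = solve-∀

  -- Past a + N with w_a + disp ≤ a + N no b has w_b < w_a, because b ≤ w_b + disp.
  count-right-stable : ∀ (Q : ℤ → Bool) a {N₁ N₂} → W a + + D ≤ a + + N₁ → W a + + D ≤ a + + N₂ →
    countFrom (λ b → Q b ∧ does (W b <? W a)) (a + + 1) N₁ ≡ countFrom (λ b → Q b ∧ does (W b <? W a)) (a + + 1) N₂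
  count-right-stable Q a reach₁ reach₂ = [ (λ N₁≤N₂ → sym (stable reach₁ N₁≤N₂)) , stable reach₂ ]′ (ℕₚ.≤-total _ _)
    where
      P = λ b → Q b ∧ does (W b <? W a)
      stable : ∀ {N N′} → W a + + D ≤ a + + N → N ℕ.≤ N′ → countFrom P (a + + 1) N′ ≡ countFrom P (a + + 1) N
      stable {N} reach N≤N′ with ℕₚ.m≤n⇒∃[o]m+o≡n N≤N′
      ... | e , refl = count-++-none P (a + + 1) N e beyond
        where
          beyond : ∀ t → t ℕ.< e → P ((a + + 1 + + N) + + t) ≡ false
          beyond t _ = trans (cong (Q b ∧_) (dec-false (W b <? W a) not-below)) (∧-zeroʳ (Q b))
            where
              b = (a + + 1 + + N) + + t
              not-below : ¬ (W b < W a)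
              not-below Wb<Wa = ℤₚ.<-irrefl refl (begin-strict
                W b + + D   <⟨ ℤₚ.+-monoˡ-< (+ D) Wb<Wa ⟩
                W a + + D   ≤⟨ reach ⟩
                a + + N     <⟨ a+N<a+1+N+t a N t ⟩
                b           ≤⟨ j≤fun+disp w b ⟩
                W b + + D   ∎)
                where open ℤₚ.≤-Reasoning

  leftInversions-stable : ∀ i {N₁ N₂} → i - + N₁ ≤ W i - + D → i - + N₂ ≤ W i - + D →
    leftInversions w i N₁ ≡ leftInversions w i N₂
  leftInversions-stable i reach₁ reach₂ = [ (λ N₁≤N₂ → sym (stable reach₁ N₁≤N₂)) , stable reach₂ ]′ (ℕₚ.≤-total _ _)
    where
      P = λ j → does (W i <? W j)
      stable : ∀ {N N′} → i - + N ≤ W i - + D → N ℕ.≤ N′ → leftInversions w i N′ ≡ leftInversions w i N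
      stable {N} reach N≤N′ with ℕₚ.m≤n⇒∃[o]m+o≡n N≤N′
      ... | e , refl = trans (cong (countFrom P _) (ℕₚ.+-comm N e))
                         (trans (count-none-++ P _ e N before) (cong (λ z → countFrom P z N) (lemma i N e)))
        where
          lemma : ∀ i N e → (i - + (N ℕ.+ e)) + + e ≡ i - + N
          lemma i N e = trans (cong (λ z → (i - z) + + e) (ℤₚ.pos-+ N e)) (ring i (+ N) (+ e))
            where ring : ∀ i N e → (i - (N + e)) + e ≡ i - N
                  ring = solve-∀
          before : ∀ t → t ℕ.< e → P ((i - + (N ℕ.+ e)) + + t) ≡ false
          before t t<e = dec-false (W i <? W j) not-above
            where
              j = (i - + (N ℕ.+ e)) + + t
              not-above : ¬ (W i < W j)
              not-above Wi<Wj = ℤₚ.<-irrefl refl (begin-strict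
                j            <⟨ i-[N+e]+t<i-N i N t<e ⟩
                i - + N      ≤⟨ reach ⟩
                W i - + D    <⟨ ℤₚ.+-monoˡ-< (ℤ.- + D) Wi<Wj ⟩
                W j - + D    ≤⟨ i≤j+k⇒i-k≤j (fun≤j+disp w j) ⟩
                j            ∎)
                where open ℤₚ.≤-Reasoning

  private
    injective : ∀ {a b} → W a ≡ W b → a ≡ b
    injective = proj₁ (bijective w)

    does-≤≡does-< : ∀ {a b} → a ≢ b → does (W a ≤? W b) ≡ does (W a <? W b)
    does-≤≡does-< {a} {b} a≢b = does-⇔ (mk⇔ (λ le → ℤₚ.≤∧≢⇒< le (a≢b ∘ injective)) ℤₚ.<⇒≤) (W a ≤? W b) (W a <? W b)

  rightInversions-periodic : ∀ a → rightInversions w (a + + n) ≡ rightInversions w a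
  rightInversions-periodic a = count-cong ((a + + n) + + 1) (a + + 1) (2 ℕ.* D) step
    where
      lemma : ∀ a n t → ((a + n) + + 1) + t ≡ ((a + + 1) + t) + n
      lemma = solve-∀
      shifted : ∀ b → does (W (b + + n) <? W (a + + n)) ≡ does (W b <? W a)
      shifted b = trans (cong₂ (λ x y → does (x <? y)) (periodic w b) (periodic w a))
                        (does-⇔ (mk⇔ (+-cancelʳ-< (+ n)) (ℤₚ.+-monoˡ-< (+ n))) (W b + + n <? W a + + n) (W b <? W a))
      step : ∀ t → t ℕ.< 2 ℕ.* D →
             does (W (((a + + n) + + 1) + + t) <? W (a + + n)) ≡ does (W ((a + + 1) + + t) <? W a)
      step t _ = trans (cong (λ z → does (W z <? W (a + + n))) (lemma a (+ n) (+ t))) (shifted ((a + + 1) + + t))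

  len-window : ∀ s → len w ≡ sumFromℕ (rightInversions w) s n
  len-window s = trans (sum-cong (+ 1) (+ 1) n (λ t _ → cong (countFrom _ ((+ 1 + + t) + + 1)) (window-length (+ 1 + + t))))
                       (sum-periodic (rightInversions w) n rightInversions-periodic (+ 1) s)
    where
      lemma : ∀ a x → ((a + x) + + 1) - (a + + 1) ≡ x
      lemma = solve-∀
      window-length : ∀ a → intervalLength (a + + 1) (a + + (2 ℕ.* D)) ≡ 2 ℕ.* D
      window-length a = intervalLength≡ (a + + 1) (a + + (2 ℕ.* D)) (2 ℕ.* D) (lemma a (+ (2 ℕ.* D)))

  rank'-at-fun : ∀ i → rank' w i (W i) ≡ suc (rightInversions w i)
  rank'-at-fun i with i≤j⇒∃[k]j≡i+k (j≤fun+disp w i)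
  ... | L , eL = begin
    countFrom P i (intervalLength i (W i + + D))   ≡⟨ cong (countFrom P i) (intervalLength≡ i (W i + + D) (suc L) length) ⟩
    countFrom P i (suc L)                          ≡⟨ count-cons P i L ⟩
    𝟙 (P i) ℕ.+ countFrom P (i + + 1) L            ≡⟨ cong₂ ℕ._+_ (cong 𝟙 diagonal) (count-cong (i + + 1) (i + + 1) L strict) ⟩
    suc (countFrom Q (i + + 1) L)                  ≡⟨ cong suc stable ⟩
    suc (rightInversions w i)                      ∎
    where
      open ≡-Reasoning
      P = λ j → does (W j ≤? W i)
      Q = λ j → does (W j <? W i)
      lemma : ∀ i x → ((i + x) + + 1) - i ≡ + 1 + x
      lemma = solve-∀
      length : (W i + + D + + 1) - i ≡ + suc L
      length = trans (cong (λ z → (z + + 1) - i) eL) (trans (lemma i (+ L)) (sym (ℤₚ.pos-+ 1 L)))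
      diagonal : P i ≡ true
      diagonal = dec-true (W i ≤? W i) ℤₚ.≤-refl
      stable : countFrom Q (i + + 1) L ≡ rightInversions w i
      stable = count-right-stable (λ _ → true) i (ℤₚ.≤-reflexive eL) (reach-right i ℕₚ.≤-refl)
      strict : ∀ t → t ℕ.< L → P ((i + + 1) + + t) ≡ Q ((i + + 1) + + t)
      strict t _ = does-≤≡does-< (λ eq → ℤₚ.<-irrefl (sym eq) (subst (i <_) (i+suc[t]≡i+1+t i t) (i<i+suc[k] i t)))

  rank-at-fun : ∀ i N → i - + N ≤ W i - + D → rank w i (W i) ≡ suc (leftInversions w i N)
  rank-at-fun i N reach with i≤j⇒∃[k]j≡i+k (i≤j+k⇒i-k≤j (fun≤j+disp w i))
  ... | L , eL = begin
    countFrom P lo (intervalLength lo i)          ≡⟨ cong (countFrom P lo) (intervalLength≡ lo i (suc L) length) ⟩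
    countFrom P lo (suc L)                        ≡⟨ count-snoc P lo L ⟩
    countFrom P lo L ℕ.+ 𝟙 (P (lo + + L))         ≡⟨ cong₂ ℕ._+_ (count-cong lo (i - + L) L strict) (cong 𝟙 last) ⟩
    leftInversions w i L ℕ.+ 1                    ≡⟨ ℕₚ.+-comm _ 1 ⟩
    suc (leftInversions w i L)                    ≡⟨ cong suc (leftInversions-stable i (ℤₚ.≤-reflexive (sym lo≡i-L)) reach) ⟩
    suc (leftInversions w i N)                    ∎
    where
      open ≡-Reasoning
      lo = W i - + D
      P = λ j → does (W i ≤? W j)
      lemma : ∀ i x → ((i + x) + + 1) - i ≡ + 1 + x
      lemma = solve-∀
      length : (i + + 1) - lo ≡ + suc L
      length = trans (cong (λ z → (z + + 1) - lo) eL) (trans (lemma lo (+ L)) (sym (ℤₚ.pos-+ 1 L)))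
      lemma′ : ∀ a x → (a + x) - x ≡ a
      lemma′ = solve-∀
      lo≡i-L : lo ≡ i - + L
      lo≡i-L = trans (sym (lemma′ lo (+ L))) (cong (_- + L) (sym eL))
      last : P (lo + + L) ≡ true
      last = trans (cong (λ z → does (W i ≤? W z)) (sym eL)) (dec-true (W i ≤? W i) ℤₚ.≤-refl)
      strict : ∀ t → t ℕ.< L → P (lo + + t) ≡ does (W i <? W ((i - + L) + + t))
      strict t t<L rewrite lo≡i-L = does-≤≡does-< (λ eq → ℤₚ.<-irrefl (sym eq) (i-N+t<i i t<L))

module _ {h : ℤ → ℤ} (h-mono : h Preserves _<_ ⟶ _<_) where

  increasing⇒mono-≤ : ∀ {a b} → a ≤ b → h a ≤ h b
  increasing⇒mono-≤ {a} {b} a≤b with ℤₚ.<-cmp a b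
  ... | tri< a<b _ _ = ℤₚ.<⇒≤ (h-mono a<b)
  ... | tri≈ _ refl _ = ℤₚ.≤-refl
  ... | tri> _ _ b<a = ⊥-elim (ℤₚ.≤⇒≯ a≤b b<a)

  increasing⇒expanding : ∀ l M → h l + + M ≤ h (l + + M)
  increasing⇒expanding l zero    = ℤₚ.≤-reflexive (trans (ℤₚ.+-identityʳ (h l)) (cong h (sym (ℤₚ.+-identityʳ l))))
  increasing⇒expanding l (suc M) = begin
    h l + + suc M          ≡⟨ i+suc[t]≡i+t+1 (h l) M ⟩
    (h l + + M) + + 1      ≤⟨ ℤₚ.+-monoˡ-≤ (+ 1) (increasing⇒expanding l M) ⟩
    h (l + + M) + + 1      ≡⟨ ℤₚ.+-comm (h (l + + M)) (+ 1) ⟩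
    + 1 + h (l + + M)      ≤⟨ ℤₚ.i<j⇒suc[i]≤j (h-mono (i<i+suc[k] (l + + M) 0)) ⟩
    h (l + + M + + 1)      ≡⟨ cong h (sym (i+suc[t]≡i+t+1 l M)) ⟩
    h (l + + suc M)        ∎
    where open ℤₚ.≤-Reasoning

module _ {h : ℤ → ℤ} {S : ℤ → Bool}
         (h-mono : h Preserves _<_ ⟶ _<_)
         (image-S : ∀ j → S j ≡ true → ∃ λ k → h k ≡ j) where

  next-image : ∀ {a c} → h a ≡ c → S (c + + 1) ≡ true → h (a + + 1) ≡ c + + 1
  next-image {a} {c} refl S[c+1] with image-S (c + + 1) S[c+1]
  ... | k , hk≡c+1 with ℤₚ.<-cmp (a + + 1) k
  ... | tri≈ _ refl _ = hk≡c+1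
  ... | tri< a+1<k _ _ = ⊥-elim (no-integer-between (h-mono (i<i+suc[k] a 0)) (subst (h (a + + 1) <_) hk≡c+1 (h-mono a+1<k)))
  ... | tri> _ _ k<a+1 = ⊥-elim (no-integer-between (reflects-< h h-mono (subst (h a <_) (sym hk≡c+1) (i<i+suc[k] (h a) 0))) k<a+1)

module _ {h : ℤ → ℤ} {S : ℤ → Bool}
         (h-mono : h Preserves _<_ ⟶ _<_)
         (S-image : ∀ k → S (h k) ≡ true)
         (image-S : ∀ j → S j ≡ true → ∃ λ k → h k ≡ j)
         (P : ℤ → Bool) where

  private
    SP : ℤ → Bool
    SP j = S j ∧ P j

    outside-image : ∀ k j → h k < j → j < h (k + + 1) → SP j ≡ false
    outside-image k j hk<j j<hk+1 with S j in Sj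
    ... | false = refl
    ... | true with image-S j Sj
    ...   | m , refl = ⊥-elim (no-integer-between (reflects-< h h-mono hk<j) (reflects-< h h-mono j<hk+1))

  count-between-images : ∀ k δ → h (k + + 1) ≡ h k + + suc δ →
    countFrom SP (h k + + 1) (suc δ) ≡ 𝟙 (P (h (k + + 1)))
  count-between-images k δ eq = begin
    countFrom SP (h k + + 1) (suc δ)                         ≡⟨ count-snoc SP (h k + + 1) δ ⟩
    countFrom SP (h k + + 1) δ ℕ.+ 𝟙 (SP (h k + + 1 + + δ))  ≡⟨ cong₂ ℕ._+_ (count-none SP (h k + + 1) δ between) (cong (𝟙 ∘ SP) last) ⟩
    𝟙 (SP (h (k + + 1)))                                     ≡⟨ cong (λ s → 𝟙 (s ∧ P (h (k + + 1)))) (S-image (k + + 1)) ⟩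
    𝟙 (P (h (k + + 1)))                                      ∎
    where
      open ≡-Reasoning
      last : h k + + 1 + + δ ≡ h (k + + 1)
      last = trans (sym (i+suc[t]≡i+1+t (h k) δ)) (sym eq)
      between : ∀ t → t ℕ.< δ → SP (h k + + 1 + + t) ≡ false
      between t t<δ = outside-image k _
        (subst (h k <_) (i+suc[t]≡i+1+t (h k) t) (i<i+suc[k] (h k) t))
        (subst (h k + + 1 + + t <_) last (ℤₚ.+-monoʳ-< (h k + + 1) (ℤ.+<+ t<δ)))

  count-image : ∀ l M Δ → h (l + + M) ≡ h l + + Δ →
    countFrom (P ∘ h) (l + + 1) M ≡ countFrom SP (h l + + 1) Δ
  count-image l zero zero    _  = refl
  count-image l zero (suc Δ) eq = ⊥-elim (ℤₚ.<-irrefl (trans (cong h (sym (ℤₚ.+-identityʳ l))) eq) (i<i+suc[k] (h l) Δ))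
  count-image l (suc M) Δ eq with i≤j⇒∃[k]j≡i+k (increasing⇒mono-≤ h-mono (ℤₚ.i≤i+j l (+ M)))
                              | i<j⇒∃[k]j≡i+suc[k] (h-mono (i<i+suc[k] (l + + M) 0))
  ... | Δ₀ , eq₀ | δ , eqδ = begin
    countFrom (P ∘ h) (l + + 1) (suc M)
      ≡⟨ count-snoc (P ∘ h) (l + + 1) M ⟩
    countFrom (P ∘ h) (l + + 1) M ℕ.+ 𝟙 (P (h (l + + 1 + + M)))
      ≡⟨ cong₂ ℕ._+_ (count-image l M Δ₀ eq₀) (cong (λ z → 𝟙 (P (h z))) (lemma l (+ M))) ⟩
    countFrom SP (h l + + 1) Δ₀ ℕ.+ 𝟙 (P (h (l + + M + + 1)))
      ≡⟨ cong (countFrom SP (h l + + 1) Δ₀ ℕ.+_) (sym (count-between-images (l + + M) δ eqδ)) ⟩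
    countFrom SP (h l + + 1) Δ₀ ℕ.+ countFrom SP (h (l + + M) + + 1) (suc δ)
      ≡⟨ cong (λ z → countFrom SP (h l + + 1) Δ₀ ℕ.+ countFrom SP z (suc δ)) (trans (cong (_+ + 1) eq₀) (sym (lemma (h l) (+ Δ₀)))) ⟩
    countFrom SP (h l + + 1) Δ₀ ℕ.+ countFrom SP (h l + + 1 + + Δ₀) (suc δ)
      ≡⟨ sym (count-++ SP (h l + + 1) Δ₀ (suc δ)) ⟩
    countFrom SP (h l + + 1) (Δ₀ ℕ.+ suc δ)
      ≡⟨ cong (countFrom SP (h l + + 1)) (sym Δ≡Δ₀+suc[δ]) ⟩
    countFrom SP (h l + + 1) Δ ∎
    where
      open ≡-Reasoning
      lemma : ∀ a b → (a + + 1) + b ≡ (a + b) + + 1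
      lemma = solve-∀
      Δ≡Δ₀+suc[δ] : Δ ≡ Δ₀ ℕ.+ suc δ
      Δ≡Δ₀+suc[δ] = ℤₚ.+-injective (+-cancelˡ-≡ (h l) (+ Δ) (+ (Δ₀ ℕ.+ suc δ)) (begin
        h l + + Δ                   ≡⟨ sym eq ⟩
        h (l + + suc M)             ≡⟨ cong h (i+suc[t]≡i+t+1 l M) ⟩
        h (l + + M + + 1)           ≡⟨ eqδ ⟩
        h (l + + M) + + suc δ       ≡⟨ cong (_+ + suc δ) eq₀ ⟩
        (h l + + Δ₀) + + suc δ      ≡⟨ ℤₚ.+-assoc (h l) (+ Δ₀) (+ suc δ) ⟩
        h l + (+ Δ₀ + + suc δ)      ≡⟨ cong (λ z → h l + z) (sym (ℤₚ.pos-+ Δ₀ (suc δ))) ⟩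
        h l + + (Δ₀ ℕ.+ suc δ)      ∎))

-- Deleting the column class of i

-- a ≡[mod n ] b unfolds to n ℕD.∣ ∣ a - b ∣, which ℕ decides.
_≡[mod_]?_ : ∀ a n b → Dec (a ≡[mod n ] b)
a ≡[mod n ]? b = n ℕD.∣? ∣ a - b ∣

≡[mod]-refl : ∀ n a → a ≡[mod n ] a
≡[mod]-refl n a = subst (λ z → n ℕD.∣ ∣ z ∣) (sym (ℤₚ.+-inverseʳ a)) (n ℕD.∣0)

≡[mod]-+-multiple : ∀ n a b p → a ≡[mod n ] b → (a + p * + n) ≡[mod n ] b
≡[mod]-+-multiple n a b p a≡b = ℤD.∣⇒∣ᵤ (subst (ℤD._∣_ (+ n)) (lemma a b p (+ n))
  (ℤD.∣m∣n⇒∣m+n (ℤD.∣ᵤ⇒∣ {+ n} {a - b} a≡b) (ℤD.∣n⇒∣m*n p ℤD.∣-refl)))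
  where lemma : ∀ a b p n → (a - b) + p * n ≡ (a + p * n) - b
        lemma = solve-∀

≢[mod]-+-nonmultiple : ∀ n a b s → a ≡[mod n ] b → 0 ℕ.< s → s ℕ.< n → ¬ ((a + + s) ≡[mod n ] b)
≢[mod]-+-nonmultiple n a b s a≡b 0<s s<n a+s≡b = ℕₚ.<⇒≱ s<n (ℕD.∣⇒≤ {{ℕ.>-nonZero 0<s}} n∣s)
  where
    lemma : ∀ a s b → (a + s) - b ≡ (a - b) + s
    lemma = solve-∀
    n∣s : n ℕD.∣ s
    n∣s = ℤD.∣⇒∣ᵤ {+ n} {+ s}
      (ℤD.∣m+n∣m⇒∣n (subst (ℤD._∣_ (+ n)) (lemma a (+ s) b) (ℤD.∣ᵤ⇒∣ {+ n} {(a + + s) - b} a+s≡b)) (ℤD.∣ᵤ⇒∣ {+ n} {a - b} a≡b))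

inClass : ℕ → ℤ → ℤ → Bool
inClass n i b = does (b ≡[mod n ]? i)

module _ {m} (w : AffPerm (suc (suc m))) (i : ℤ) (v : AffPerm (suc m)) {f g : ℤ → ℤ}
         (f-mono : ∀ k l → k < l → f k < f l)
         (f-avoids : ∀ k → ¬ (f k ≡[mod suc (suc m) ] i))
         (f-onto : ∀ j → ¬ (j ≡[mod suc (suc m) ] i) → ∃ λ k → f k ≡ j)
         (g-mono : ∀ k l → k < l → g k < g l)
         (w∘f≡g∘v : ∀ k → fun w (f k) ≡ g (fun v k)) where

  private
    n = suc (suc m)
    W = fun w
    V = fun v
    S = not ∘ inClass n i

    f-increasing : f Preserves _<_ ⟶ _<_
    f-increasing = f-mono _ _

    g-increasing : g Preserves _<_ ⟶ _<_
    g-increasing = g-mono _ _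

    S-image : ∀ k → S (f k) ≡ true
    S-image k = cong not (dec-false (f k ≡[mod n ]? i) (f-avoids k))

    image-S : ∀ j → S j ≡ true → ∃ λ k → f k ≡ j
    image-S j Sj = f-onto j (λ j≡i → contradiction (trans (sym (cong not (dec-true (j ≡[mod n ]? i) j≡i))) Sj) λ ())

    S[i+1+t] : ∀ t → t ℕ.< suc m → S ((i + + 1) + + t) ≡ true
    S[i+1+t] t t<m = cong not (dec-false (((i + + 1) + + t) ≡[mod n ]? i)
      (subst (λ z → ¬ (z ≡[mod n ] i)) (i+suc[t]≡i+1+t i t) (≢[mod]-+-nonmultiple n i i (suc t) (≡[mod]-refl n i) (s≤s z≤n) (s≤s t<m))))

    first-image : ∃ λ k → f k ≡ i + + 1
    first-image = image-S (i + + 1) (subst (λ z → S z ≡ true) (ℤₚ.+-identityʳ (i + + 1)) (S[i+1+t] 0 (s≤s z≤n)))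

    k₀ = proj₁ first-image

    f-consecutive : ∀ t → t ℕ.< suc m → f (k₀ + + t) ≡ (i + + 1) + + t
    f-consecutive zero    _ = trans (cong f (ℤₚ.+-identityʳ k₀)) (trans (proj₂ first-image) (sym (ℤₚ.+-identityʳ (i + + 1))))
    f-consecutive (suc t) (s≤s t<m) = begin
      f (k₀ + + suc t)             ≡⟨ cong f (i+suc[t]≡i+t+1 k₀ t) ⟩
      f (k₀ + + t + + 1)           ≡⟨ next-image f-increasing image-S (f-consecutive t (ℕₚ.m<n⇒m<1+n t<m)) S[next] ⟩
      (i + + 1) + + t + + 1        ≡⟨ sym (i+suc[t]≡i+t+1 (i + + 1) t) ⟩
      (i + + 1) + + suc t          ∎
      where
        open ≡-Reasoning
        S[next] : S ((i + + 1) + + t + + 1) ≡ true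
        S[next] = subst (λ z → S z ≡ true) (i+suc[t]≡i+t+1 (i + + 1) t) (S[i+1+t] (suc t) (s≤s t<m))

    cutoff = 2 ℕ.* disp v ℕ.+ 2 ℕ.* disp w

    inversions-transfer : ∀ l → rightInversions v l ≡ rightInversionsWith w S (f l)
    inversions-transfer l with i≤j⇒∃[k]j≡i+k (increasing⇒mono-≤ f-increasing (ℤₚ.i≤i+j l (+ cutoff)))
    ... | Δ , eqΔ = begin
      countFrom (λ x → does (V x <? V l)) (l + + 1) (2 ℕ.* disp v)
        ≡⟨ count-right-stable v (λ _ → true) l (reach-right v l ℕₚ.≤-refl) (reach-right v l (ℕₚ.m≤m+n _ _)) ⟩
      countFrom (λ x → does (V x <? V l)) (l + + 1) cutoff
        ≡⟨ count-cong (l + + 1) (l + + 1) cutoff (λ t _ → transfer ((l + + 1) + + t)) ⟩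
      countFrom (λ x → does (W (f x) <? W (f l))) (l + + 1) cutoff
        ≡⟨ count-image f-increasing S-image image-S (λ b → does (W b <? W (f l))) l cutoff Δ eqΔ ⟩
      countFrom (λ b → S b ∧ does (W b <? W (f l))) (f l + + 1) Δ
        ≡⟨ count-right-stable w S (f l) reachΔ (reach-right w (f l) ℕₚ.≤-refl) ⟩
      rightInversionsWith w S (f l) ∎
      where
        open ≡-Reasoning
        transfer : ∀ x → does (V x <? V l) ≡ does (W (f x) <? W (f l))
        transfer x = trans (does-⇔ (mk⇔ g-increasing (reflects-< g g-increasing)) (V x <? V l) (g (V x) <? g (V l)))
                           (sym (cong₂ (λ a b → does (a <? b)) (w∘f≡g∘v x) (w∘f≡g∘v l)))
        reachΔ : W (f l) + + disp w ≤ f l + + Δ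
        reachΔ = ℤₚ.≤-trans (reach-right w (f l) (ℕₚ.m≤n+m (2 ℕ.* disp w) (2 ℕ.* disp v)))
                   (ℤₚ.≤-trans (increasing⇒expanding f-increasing l cutoff) (ℤₚ.≤-reflexive eqΔ))

  len-deletion : len v ≡ sumFromℕ (rightInversionsWith w (not ∘ inClass n i)) (i + + 1) (suc m)
  len-deletion = trans (len-window v k₀)
    (sum-cong k₀ (i + + 1) (suc m) (λ t t<m → trans (inversions-transfer (k₀ + + t)) (cong (rightInversionsWith w S) (f-consecutive t t<m))))

-- Inversions into the column class of i

module _ {m} (w : AffPerm (suc (suc m))) (i : ℤ) where
  private
    n = suc (suc m)
    W = fun w
    D = disp w

  -- below p a records the inversion (a, i + pn).  Summed over i < a < i+n and p ≥ 1 it counts the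
  -- inversions from the window into the class of i, and, after translating by −pn, the pairs (j, i)
  -- with j < i and w_j > w_i.
  below : ℤ → ℤ → ℕ
  below p a = 𝟙 (does (W (i + p * + n) <? W a))

  inClassBelow : ℤ → ℤ → Bool
  inClassBelow a b = inClass n i b ∧ does (W b <? W a)

  above : ℤ → Bool
  above j = does (W i <? W j)

  private
    outside-class : ∀ c → c ≡[mod n ] i → ∀ s → s ℕ.< suc m → ∀ a → inClassBelow a ((c + + 1) + + s) ≡ false
    outside-class c c≡i s s<m a = cong (_∧ does (W ((c + + 1) + + s) <? W a))
      (dec-false (((c + + 1) + + s) ≡[mod n ]? i)
        (subst (λ z → ¬ (z ≡[mod n ] i)) (i+suc[t]≡i+1+t c s) (≢[mod]-+-nonmultiple n c i (suc s) c≡i (s≤s z≤n) (s≤s s<m))))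

  -- Of the n columns following i + Kn, only the last one lies in the class of i.
  count-class-block : ∀ a K → countFrom (inClassBelow a) ((i + + 1) + + (K ℕ.* n)) n ≡ below (+ suc K) a
  count-class-block a K = begin
    countFrom (inClassBelow a) ((i + + 1) + + (K ℕ.* n)) n
      ≡⟨ cong (λ z → countFrom (inClassBelow a) z n) base ⟩
    countFrom (inClassBelow a) (c + + 1) n
      ≡⟨ count-snoc (inClassBelow a) (c + + 1) (suc m) ⟩
    countFrom (inClassBelow a) (c + + 1) (suc m) ℕ.+ 𝟙 (inClassBelow a ((c + + 1) + + suc m))
      ≡⟨ cong₂ ℕ._+_ (count-none (inClassBelow a) (c + + 1) (suc m) (λ s s<m → outside-class c c≡i s s<m a))
                     (cong (𝟙 ∘ inClassBelow a) last) ⟩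
    𝟙 (inClassBelow a (i + + suc K * + n))
      ≡⟨ cong (λ z → 𝟙 (z ∧ does (W (i + + suc K * + n) <? W a))) last-in-class ⟩
    below (+ suc K) a ∎
    where
      open ≡-Reasoning
      c = i + + K * + n
      c≡i : c ≡[mod n ] i
      c≡i = ≡[mod]-+-multiple n i i (+ K) (≡[mod]-refl n i)
      lemma : ∀ i k → (i + + 1) + k ≡ (i + k) + + 1
      lemma = solve-∀
      base : (i + + 1) + + (K ℕ.* n) ≡ c + + 1
      base = trans (cong (λ z → (i + + 1) + z) (ℤₚ.pos-* K n)) (lemma i (+ K * + n))
      lemma′ : ∀ i k n → (i + k * n) + n ≡ i + (+ 1 + k) * n
      lemma′ = solve-∀
      last-in-class : inClass n i (i + + suc K * + n) ≡ true
      last-in-class = dec-true ((i + + suc K * + n) ≡[mod n ]? i) (≡[mod]-+-multiple n i i (+ suc K) (≡[mod]-refl n i))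
      last : (c + + 1) + + suc m ≡ i + + suc K * + n
      last = trans (sym (i+suc[t]≡i+1+t c (suc m)))
                   (trans (lemma′ i (+ K) (+ n)) (cong (λ z → i + z * + n) (sym (ℤₚ.pos-+ 1 K))))

  count-class-blocks : ∀ a K → countFrom (inClassBelow a) (i + + 1) (K ℕ.* n) ≡ sumFromℕ (λ p → below p a) (+ 1) K
  count-class-blocks a zero    = refl
  count-class-blocks a (suc K) = begin
    countFrom (inClassBelow a) (i + + 1) (n ℕ.+ K ℕ.* n)
      ≡⟨ cong (countFrom (inClassBelow a) (i + + 1)) (ℕₚ.+-comm n (K ℕ.* n)) ⟩
    countFrom (inClassBelow a) (i + + 1) (K ℕ.* n ℕ.+ n)
      ≡⟨ count-++ (inClassBelow a) (i + + 1) (K ℕ.* n) n ⟩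
    countFrom (inClassBelow a) (i + + 1) (K ℕ.* n) ℕ.+ countFrom (inClassBelow a) ((i + + 1) + + (K ℕ.* n)) n
      ≡⟨ cong₂ ℕ._+_ (count-class-blocks a K) (count-class-block a K) ⟩
    sumFromℕ (λ p → below p a) (+ 1) K ℕ.+ below (+ suc K) a
      ≡⟨ cong (λ z → sumFromℕ (λ p → below p a) (+ 1) K ℕ.+ below z a) (ℤₚ.pos-+ 1 K) ⟩
    sumFromℕ (λ p → below p a) (+ 1) K ℕ.+ below (+ 1 + + K) a
      ≡⟨ sym (sum-snoc (λ p → below p a) (+ 1) K) ⟩
    sumFromℕ (λ p → below p a) (+ 1) (suc K) ∎
    where open ≡-Reasoning

  -- K₀ n exceeds 2 disp w, so K₀ blocks of n columns contain every inversion partner.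
  K₀ : ℕ
  K₀ = suc (2 ℕ.* D)

  rightInversions-in-class : ∀ t → t ℕ.< suc m →
    rightInversionsWith w (inClass n i) ((i + + 1) + + t) ≡ sumFromℕ (λ p → below p ((i + + 1) + + t)) (+ 1) K₀
  rightInversions-in-class t t<m with ℕₚ.m≤n⇒∃[o]m+o≡n (ℕₚ.m<n⇒m<1+n t<m)
  ... | r , t+r≡n = begin
    countFrom (inClassBelow a) (a + + 1) (2 ℕ.* D)
      ≡⟨ count-right-stable w (inClass n i) a (reach-right w a ℕₚ.≤-refl) (reach-right w a 2D≤E) ⟩
    countFrom (inClassBelow a) (a + + 1) E
      ≡⟨ cong (λ z → countFrom (inClassBelow a) z E) (sym (i+suc[t]≡i+t+1 (i + + 1) t)) ⟩
    countFrom (inClassBelow a) ((i + + 1) + + suc t) E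
      ≡⟨ sym (count-none-++ (inClassBelow a) (i + + 1) (suc t) E leading) ⟩
    countFrom (inClassBelow a) (i + + 1) (suc t ℕ.+ E)
      ≡⟨ cong (countFrom (inClassBelow a) (i + + 1)) length ⟩
    countFrom (inClassBelow a) (i + + 1) (K₀ ℕ.* n)
      ≡⟨ count-class-blocks a K₀ ⟩
    sumFromℕ (λ p → below p a) (+ 1) K₀ ∎
    where
      open ≡-Reasoning
      a = (i + + 1) + + t
      E = r ℕ.+ 2 ℕ.* D ℕ.* n
      2D≤E : 2 ℕ.* D ℕ.≤ E
      2D≤E = ℕₚ.≤-trans (ℕₚ.m≤m*n (2 ℕ.* D) n) (ℕₚ.m≤n+m _ r)
      length : suc t ℕ.+ E ≡ K₀ ℕ.* n
      length = trans (sym (ℕₚ.+-assoc (suc t) r _)) (cong (ℕ._+ 2 ℕ.* D ℕ.* n) t+r≡n)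
      leading : ∀ s → s ℕ.< suc t → inClassBelow a ((i + + 1) + + s) ≡ false
      leading s (s≤s s≤t) = outside-class i (≡[mod]-refl n i) s (ℕₚ.≤-<-trans s≤t t<m) a

  count-left-block : ∀ q → countFrom above (i - + suc q * + n) n ≡ sumFromℕ (below (+ suc q)) (i + + 1) (suc m)
  count-left-block q = begin
    countFrom above (i - c) n
      ≡⟨ count-cons above (i - c) (suc m) ⟩
    𝟙 (above (i - c)) ℕ.+ countFrom above ((i - c) + + 1) (suc m)
      ≡⟨ cong₂ ℕ._+_ (cong 𝟙 first) rest ⟩
    countFrom (λ a → does (W (i + c) <? W a)) (i + + 1) (suc m)
      ≡⟨ count≡sum _ (i + + 1) (suc m) ⟩
    sumFromℕ (below (+ suc q)) (i + + 1) (suc m) ∎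
    where
      open ≡-Reasoning
      c = + suc q * + n
      first : above (i - c) ≡ false
      first = dec-false (W i <? W (i - c)) (ℤₚ.≤⇒≯ (subst (_≤ W i) (sym (fun[j-pn]≡fun[j]-pn w i (+ suc q))) (ℤₚ.i-j≤i (W i) c)))
      lemma : ∀ i c t → ((i - c) + + 1) + t ≡ ((i + + 1) + t) - c
      lemma = solve-∀
      shifted : ∀ a {j} → j ≡ a - c → above j ≡ does (W (i + c) <? W a)
      shifted a refl = begin
        does (W i <? W (a - c))        ≡⟨ cong (λ z → does (W i <? z)) (fun[j-pn]≡fun[j]-pn w a (+ suc q)) ⟩
        does (W i <? W a - c)          ≡⟨ does-<-shift (W i) (W a) c ⟩
        does (W i + c <? W a)          ≡⟨ cong (λ z → does (z <? W a)) (sym (fun[j+pn]≡fun[j]+pn w i (+ suc q))) ⟩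
        does (W (i + c) <? W a)        ∎
      rest : countFrom above ((i - c) + + 1) (suc m) ≡ countFrom (λ a → does (W (i + c) <? W a)) (i + + 1) (suc m)
      rest = count-cong {above} {λ a → does (W (i + c) <? W a)} ((i - c) + + 1) (i + + 1) (suc m)
                (λ t _ → shifted ((i + + 1) + + t) (lemma i c (+ t)))

  leftInversions-blocks : ∀ K →
    leftInversions w i (K ℕ.* n) ≡ sumFromℕ (λ p → sumFromℕ (below p) (i + + 1) (suc m)) (+ 1) K
  leftInversions-blocks zero    = refl
  leftInversions-blocks (suc K) = begin
    countFrom above (i - + (n ℕ.+ K ℕ.* n)) (n ℕ.+ K ℕ.* n)
      ≡⟨ count-++ above (i - + (n ℕ.+ K ℕ.* n)) n (K ℕ.* n) ⟩
    countFrom above (i - + (n ℕ.+ K ℕ.* n)) n ℕ.+ countFrom above ((i - + (n ℕ.+ K ℕ.* n)) + + n) (K ℕ.* n)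
      ≡⟨ cong₂ ℕ._+_ (trans (cong (λ z → countFrom above (i - z) n) (ℤₚ.pos-* (suc K) n)) (count-left-block K))
                     (trans (cong (λ z → countFrom above z (K ℕ.* n)) base) (leftInversions-blocks K)) ⟩
    Inner (+ suc K) ℕ.+ sumFromℕ Inner (+ 1) K
      ≡⟨ ℕₚ.+-comm (Inner (+ suc K)) _ ⟩
    sumFromℕ Inner (+ 1) K ℕ.+ Inner (+ suc K)
      ≡⟨ cong (λ z → sumFromℕ Inner (+ 1) K ℕ.+ Inner z) (ℤₚ.pos-+ 1 K) ⟩
    sumFromℕ Inner (+ 1) K ℕ.+ Inner (+ 1 + + K)
      ≡⟨ sym (sum-snoc Inner (+ 1) K) ⟩
    sumFromℕ Inner (+ 1) (suc K) ∎
    where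
      open ≡-Reasoning
      Inner = λ p → sumFromℕ (below p) (i + + 1) (suc m)
      lemma : ∀ i a b → (i - (a + b)) + a ≡ i - b
      lemma = solve-∀
      base : (i - + (n ℕ.+ K ℕ.* n)) + + n ≡ i - + (K ℕ.* n)
      base = trans (cong (λ z → (i - z) + + n) (ℤₚ.pos-+ n (K ℕ.* n))) (lemma i (+ n) (+ (K ℕ.* n)))

  class-inversions≡leftInversions :
    sumFromℕ (rightInversionsWith w (inClass n i)) (i + + 1) (suc m) ≡ leftInversions w i (K₀ ℕ.* n)
  class-inversions≡leftInversions = begin
    sumFromℕ (rightInversionsWith w (inClass n i)) (i + + 1) (suc m)
      ≡⟨ sum-cong (i + + 1) (i + + 1) (suc m) rightInversions-in-class ⟩
    sumFromℕ (λ a → sumFromℕ (λ p → below p a) (+ 1) K₀) (i + + 1) (suc m)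
      ≡⟨ sum-swap (λ a p → below p a) (i + + 1) (suc m) (+ 1) K₀ ⟩
    sumFromℕ (λ p → sumFromℕ (below p) (i + + 1) (suc m)) (+ 1) K₀
      ≡⟨ sym (leftInversions-blocks K₀) ⟩
    leftInversions w i (K₀ ℕ.* n) ∎
    where open ≡-Reasoning

rightInversions-window-split : ∀ {m} (w : AffPerm (suc (suc m))) (i : ℤ) (v : AffPerm (suc m)) → IsDeletion w i v →
  sumFromℕ (rightInversions w) (i + + 1) (suc m) ≡ leftInversions w i (K₀ w i ℕ.* suc (suc m)) ℕ.+ len v
rightInversions-window-split {m} w i v (f , g , f-mono , f-avoids , f-onto , g-mono , _ , _ , w∘f≡g∘v) = begin
  sumFromℕ (rightInversions w) (i + + 1) (suc m)
    ≡⟨ sum-cong (i + + 1) (i + + 1) (suc m) (λ t _ → partition ((i + + 1) + + t)) ⟩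
  sumFromℕ (λ a → rightInversionsWith w (inClass n i) a ℕ.+ rightInversionsWith w (not ∘ inClass n i) a) (i + + 1) (suc m)
    ≡⟨ sum-distrib-+ (rightInversionsWith w (inClass n i)) (rightInversionsWith w (not ∘ inClass n i)) (i + + 1) (suc m) ⟩
  sumFromℕ (rightInversionsWith w (inClass n i)) (i + + 1) (suc m) ℕ.+ sumFromℕ (rightInversionsWith w (not ∘ inClass n i)) (i + + 1) (suc m)
    ≡⟨ cong₂ ℕ._+_ (class-inversions≡leftInversions w i) (sym (len-deletion w i v f-mono f-avoids f-onto g-mono w∘f≡g∘v)) ⟩
  leftInversions w i (K₀ w i ℕ.* n) ℕ.+ len v ∎
  where
    open ≡-Reasoning
    n = suc (suc m)
    partition : ∀ a → rightInversions w a ≡ rightInversionsWith w (inClass n i) a ℕ.+ rightInversionsWith w (not ∘ inClass n i) a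
    partition a = count-partition (inClass n i) (λ b → does (fun w b <? fun w a)) (a + + 1) (2 ℕ.* disp w)

len+2≡len-deletion+ranks : ∀ {m} (w : AffPerm (suc (suc m))) (i : ℤ) (v : AffPerm (suc m)) → IsDeletion w i v →
  len w ℕ.+ 2 ≡ len v ℕ.+ (rank w i (fun w i) ℕ.+ rank' w i (fun w i))
len+2≡len-deletion+ranks {m} w i v deletion = begin
  len w ℕ.+ 2
    ≡⟨ cong (ℕ._+ 2) (len-window w i) ⟩
  (rightInversions w i ℕ.+ sumFromℕ (rightInversions w) (i + + 1) (suc m)) ℕ.+ 2
    ≡⟨ cong (λ z → (rightInversions w i ℕ.+ z) ℕ.+ 2) (rightInversions-window-split w i v deletion) ⟩
  (rightInversions w i ℕ.+ (leftInversions w i N ℕ.+ len v)) ℕ.+ 2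
    ≡⟨ rearrange (rightInversions w i) (leftInversions w i N) (len v) ⟩
  len v ℕ.+ (suc (leftInversions w i N) ℕ.+ suc (rightInversions w i))
    ≡⟨ cong (len v ℕ.+_) (sym (cong₂ ℕ._+_ (rank-at-fun w i N (reach-left w i 2D≤N)) (rank'-at-fun w i))) ⟩
  len v ℕ.+ (rank w i (fun w i) ℕ.+ rank' w i (fun w i)) ∎
  where
    open ≡-Reasoning
    N = K₀ w i ℕ.* suc (suc m)
    2D≤N : 2 ℕ.* disp w ℕ.≤ N
    2D≤N = ℕₚ.≤-trans (ℕₚ.n≤1+n _) (ℕₚ.m≤m*n (K₀ w i) (suc (suc m)))
    rearrange : ∀ R L V → (R ℕ.+ (L ℕ.+ V)) ℕ.+ 2 ≡ V ℕ.+ (suc L ℕ.+ suc R)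
    rearrange = ℕ-solve-∀

+a-+b≡+c-+d : ∀ {a b c d s} → a ℕ.+ 2 ≡ c ℕ.+ s → b ℕ.+ 2 ≡ d ℕ.+ s → + a - + b ≡ + c - + d
+a-+b≡+c-+d {a} {b} {c} {d} {s} eqa eqb = begin
  + a - + b                      ≡⟨ lemma (+ a) (+ b) (+ 2) ⟩
  (+ a + + 2) - (+ b + + 2)      ≡⟨ cong₂ _-_ (trans (sym (ℤₚ.pos-+ a 2)) (cong +_ eqa)) (trans (sym (ℤₚ.pos-+ b 2)) (cong +_ eqb)) ⟩
  + (c ℕ.+ s) - + (d ℕ.+ s)      ≡⟨ cong₂ _-_ (ℤₚ.pos-+ c s) (ℤₚ.pos-+ d s) ⟩
  (+ c + + s) - (+ d + + s)      ≡⟨ sym (lemma (+ c) (+ d) (+ s)) ⟩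
  + c - + d                      ∎
  where
    open ≡-Reasoning
    lemma : ∀ a b k → a - b ≡ (a + k) - (b + k)
    lemma = solve-∀

+a-+b≡0⇒a≡b : ∀ {a b} → + a - + b ≡ + 0 → a ≡ b
+a-+b≡0⇒a≡b {a} {b} eq = ℤₚ.+-injective (ℤₚ.i-j≡0⇒i≡j (+ a) (+ b) eq)

lemma5p1 : (n : ℕ) → 2 ℕ.≤ n → (x w : AffPerm n) → x <B w → (i : ℤ) →
    fun x i ≡ fun w i → d x w i (fun x i) ≡ + 0 → d' x w i (fun x i) ≡ + 0 →
    (xî wî : AffPerm (n ∸ 1)) → IsDeletion x i xî → IsDeletion w i wî →
    (+ len w) - (+ len x) ≡ (+ len wî) - (+ len xî)
lemma5p1 (suc zero) (s≤s ()) _ _ _ _ _ _ _ _ _ _ _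
lemma5p1 (suc (suc m)) _ x w _ i x[i]≡w[i] d≡0 d′≡0 xî wî x-deletion w-deletion =
  +a-+b≡+c-+d {len w} {len x} {len wî} {len xî} {rank w i (fun w i) ℕ.+ rank' w i (fun w i)} (len+2≡len-deletion+ranks w i wî w-deletion)
    (subst (λ s → len x ℕ.+ 2 ≡ len xî ℕ.+ s) (cong₂ ℕ._+_ same-rank same-rank′) (len+2≡len-deletion+ranks x i xî x-deletion))
  where
    same-rank : rank x i (fun x i) ≡ rank w i (fun w i)
    same-rank = trans (sym (+a-+b≡0⇒a≡b d≡0)) (cong (rank w i) x[i]≡w[i])
    same-rank′ : rank' x i (fun x i) ≡ rank' w i (fun w i)
    same-rank′ = trans (sym (+a-+b≡0⇒a≡b d′≡0)) (cong (rank' w i) x[i]≡w[i])
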